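{- For every finite simple graph $G$, $\operatorname{col}'_g(G)\leq \operatorname{col}''_g(G)$.
   Context: All graphs are finite and simple. Call two objects of $G$ (vertices or edges) neighbors if they are incident: two adjacent vertices, a vertex and an edge containing it, or two distinct edges sharing an endpoint. Total marking game with parameter $k\in\mathbb{N}$ on $G$: Alice and Bob alternately mark unmarked vertices or edges of $G$, Alice moving first, until all objects are marked. Alice wins if at every moment of the game every unmarked vertex and every unmarked edge has at most $k-1$ marked neighbors; otherwise Bob wins. The total game coloring number $\operatorname{col}''_g(G)$ is the least $k$ for which Alice has a winning strategy. Edge marking game with parameter $k$ on $G$: Alice and Bob alternately mark unmarked edges of $G$, Alice first, until all edges are marked; Alice wins if at every moment every unmarked edge has at most $k-1$ marked edges sharing an endpoint with it; otherwise Bob wins. The game coloring index $\operatorname{col}'_g(G)$ is the least $k$ for which Alice has a winning strategy in the edge marking game. -}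

module Defs where

open import Data.Nat using (ℕ; zero; suc; _≤_; _<_)
open import Data.Fin using (Fin)
import Data.Fin as F
open import Data.Fin.Properties using (_≟_)
open import Data.Bool using (Bool; true; false; T; _∧_; _∨_; not; if_then_else_)
open import Data.Product using (Σ; _×_; _,_; proj₁; proj₂)
open import Data.List using (List; []; _∷_; length; filterᵇ)
open import Data.List.Membership.Propositional using (_∈_; _∉_)
open import Relation.Nullary using (¬_)
open import Relation.Nullary.Decidable using (⌊_⌋)
open import Relation.Binary.PropositionalEquality using (_≡_)

record Graph : Set where
  field
    n      : ℕ
    adj    : Fin n → Fin n → Bool
    sym    : ∀ i j → adj i j ≡ adj j i
    irrefl : ∀ i → adj i i ≡ false
open Graph public

-- An edge {i,j} represented by its endpoints with i < j.
Edge : Graph → Set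
Edge G = Σ (Fin (n G)) λ i → Σ (Fin (n G)) λ j → (i F.< j) × T (adj G i j)

src tgt : {G : Graph} → Edge G → Fin (n G)
src e = proj₁ e
tgt e = proj₁ (proj₂ e)

_==_ : {m : ℕ} → Fin m → Fin m → Bool
i == j = ⌊ i ≟ j ⌋

incV : {G : Graph} → Fin (n G) → Edge G → Bool
incV {G} u e = (u == src {G} e) ∨ (u == tgt {G} e)

sameEdge : {G : Graph} → Edge G → Edge G → Bool
sameEdge {G} e f = (src {G} e == src {G} f) ∧ (tgt {G} e == tgt {G} f)

edgeNb : {G : Graph} → Edge G → Edge G → Bool
edgeNb {G} e f = not (sameEdge {G} e f) ∧ (incV {G} (src {G} e) f ∨ incV {G} (tgt {G} e) f)

data TObj (G : Graph) : Set where
  vert : Fin (n G) → TObj G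
  edge : Edge G → TObj G

totalNb : {G : Graph} → TObj G → TObj G → Bool
totalNb {G} (vert u) (vert v) = adj G u v
totalNb {G} (vert u) (edge e) = incV {G} u e
totalNb {G} (edge e) (vert v) = incV {G} v e
totalNb {G} (edge e) (edge f) = edgeNb {G} e f

-- Generic marking game on an object type O with a neighbor relation nb
-- and parameter k.  A position is the list of marked objects.

data Turn : Set where
  alice bob : Turn

module Game {O : Set} (nb : O → O → Bool) (k : ℕ) where

  markedNb : List O → O → ℕ
  markedNb S o = length (filterᵇ (nb o) S)

  Good : List O → Set
  Good S = ∀ o → o ∉ S → markedNb S o < k

  AllMarked : List O → Set
  AllMarked S = ∀ o → o ∈ S

  -- AWin S t : from position S with player t to move, Alice can force
  -- that every position from now on (including S) is Good until all
  -- objects are marked.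
  data AWin : List O → Turn → Set where
    finished   : ∀ {S t} → Good S → AllMarked S → AWin S t
    aliceMoves : ∀ {S} → Good S → (o : O) → o ∉ S →
                 AWin (o ∷ S) bob → AWin S alice
    bobMoves   : ∀ {S} → Good S →
                 (∀ o → o ∉ S → AWin (o ∷ S) alice) → AWin S bob

  AliceWins : Set
  AliceWins = AWin [] alice

AliceWinsTotal : Graph → ℕ → Set
AliceWinsTotal G k = Game.AliceWins (totalNb {G}) k

AliceWinsEdge : Graph → ℕ → Set
AliceWinsEdge G k = Game.AliceWins (edgeNb {G}) k

IsLeast : (ℕ → Set) → ℕ → Set
IsLeast W k = W k × (∀ j → W j → k ≤ j)

IsTotalGameColoringNumber : Graph → ℕ → Set
IsTotalGameColoringNumber G = IsLeast (AliceWinsTotal G)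

IsGameColoringIndex : Graph → ℕ → Set
IsGameColoringIndex G = IsLeast (AliceWinsEdge G)

module Submission where

-- Alice plays the edge game while
-- privately running a winning total-game strategy on an imaginary board.
-- Her real edge moves and Bob's real edge moves are copied to the
-- imaginary board; when her total strategy marks a vertex she lets an
-- imaginary Bob answer by marking another vertex.  Once every vertex is
-- marked the imaginary game runs one move ahead: its proposed edge g is
-- only played after Bob's next real move f (if f = g the two games fall
-- back into step).  The invariant is that the real position is a
-- permutation of the edges marked on the imaginary board, so the marked
-- neighbours of an edge in the real game are never more than in the
-- imaginary one; when Alice delays g, its marked endpoint vertex pays for
-- the extra edge f.

open import Defs
open import Data.Nat using (ℕ; _≤_; _<_; suc; z≤n; s≤s)
open import Data.Nat.Properties using (≤-trans; ≤-refl; ≤-reflexive; ≤-<-trans; m≤n⇒m≤1+n)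
open import Data.Fin using (Fin)
import Data.Fin as F
open import Data.Fin.Properties using (_≟_; _<?_; <-irrelevant; any?)
open import Data.Bool using (Bool; true; false; T)
open import Data.Bool.Properties using (T-irrelevant)
open import Data.Product using (Σ; ∃; _,_)
open import Data.Product.Properties using (≡-dec)
open import Data.Sum using (_⊎_; inj₁; inj₂)
open import Data.List using (List; []; _∷_; length; filterᵇ)
open import Data.List.Relation.Unary.Any using (here; there)
import Data.List.Relation.Unary.Any as Any
open import Data.List.Membership.Propositional using (_∈_; _∉_)
import Data.List.Membership.DecPropositional as DecMembership
open import Data.List.Relation.Binary.Permutation.Propositional
  using (_↭_; ↭-refl; ↭-sym; prep; swap)
open import Data.List.Relation.Binary.Permutation.Propositional.Properties
  using (∈-resp-↭; ↭-length; filter-↭)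
open import Data.Empty using (⊥-elim)
open import Relation.Nullary using (Dec; yes; no)
open import Relation.Nullary.Decidable using (¬?; T?; decidable-stable; map′)
open import Relation.Binary.PropositionalEquality using (_≡_; refl; cong; cong₂)
open import Relation.Binary.Definitions using (DecidableEquality)

count : {A : Set} → (A → Bool) → List A → ℕ
count p xs = length (filterᵇ p xs)

count-↭ : {A : Set} (p : A → Bool) {xs ys : List A} → xs ↭ ys → count p xs ≡ count p ys
count-↭ p xs↭ys = ↭-length (filter-↭ (λ x → T? (p x)) xs↭ys)

count-∷-≤ : {A : Set} (p : A → Bool) (x : A) (xs : List A) → count p xs ≤ count p (x ∷ xs)
count-∷-≤ p x xs with p x
... | true  = m≤n⇒m≤1+n ≤-refl
... | false = ≤-refl

count-∷-≤suc : {A : Set} (p : A → Bool) (x : A) (xs : List A) → count p (x ∷ xs) ≤ suc (count p xs)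
count-∷-≤suc p x xs with p x
... | true  = ≤-refl
... | false = m≤n⇒m≤1+n ≤-refl

module GraphObjects (G : Graph) where

  -- Edges are determined by their endpoints (the remaining components are
  -- proofs), so edge equality is decidable.
  _≟E_ : DecidableEquality (Edge G)
  _≟E_ = ≡-dec _≟_ (≡-dec _≟_ λ (p , q) (p′ , q′) →
           yes (cong₂ _,_ (<-irrelevant p p′) (T-irrelevant q q′)))

  open DecMembership _≟E_ using () renaming (_∈?_ to _∈E?_)

  edge-injective : {e f : Edge G} → _≡_ {A = TObj G} (edge e) (edge f) → e ≡ f
  edge-injective refl = refl

  vert≟ : (u : Fin (n G)) (o : TObj G) → Dec (vert u ≡ o)
  vert≟ u (vert v) = map′ (cong vert) (λ { refl → refl }) (u ≟ v)
  vert≟ u (edge e) = no λ ()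

  UnmarkedAt : List (Edge G) → Fin (n G) → Fin (n G) → Set
  UnmarkedAt R i j = Σ (i F.< j) λ p → Σ (T (adj G i j)) λ q → (i , j , p , q) ∉ R

  unmarkedAt? : ∀ R i j → Dec (UnmarkedAt R i j)
  unmarkedAt? R i j with i <? j | T? (adj G i j)
  ... | no i≮j | _       = no λ (p , _) → i≮j p
  ... | yes _  | no ¬adj = no λ (_ , q , _) → ¬adj q
  ... | yes p  | yes q   =
    map′ (λ e∉R → p , q , e∉R) unmarked-by-endpoints (¬? ((i , j , p , q) ∈E? R))
    where
      unmarked-by-endpoints : UnmarkedAt R i j → (i , j , p , q) ∉ R
      unmarked-by-endpoints (p′ , q′ , e∉R) rewrite <-irrelevant p p′ | T-irrelevant q q′ = e∉R

  unmarkedEdge : (R : List (Edge G)) → (∀ e → e ∈ R) ⊎ ∃ λ e → e ∉ R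
  unmarkedEdge R with any? (λ i → any? (λ j → unmarkedAt? R i j))
  ... | yes (i , j , p , q , e∉R) = inj₂ ((i , j , p , q) , e∉R)
  ... | no none = inj₁ λ (i , j , p , q) →
          decidable-stable ((i , j , p , q) ∈E? R) (λ e∉R → none (i , j , p , q , e∉R))

  unmarkedVertex : (S : List (TObj G)) → (∀ u → vert u ∈ S) ⊎ ∃ λ u → vert u ∉ S
  unmarkedVertex S with any? (λ u → ¬? (Any.any? (vert≟ u) S))
  ... | yes found = inj₂ found
  ... | no none   = inj₁ λ u → decidable-stable (Any.any? (vert≟ u) S) (λ u∉S → none (u , u∉S))

  edgesOf : List (TObj G) → List (Edge G)
  edgesOf []           = []
  edgesOf (vert _ ∷ S) = edgesOf S
  edgesOf (edge e ∷ S) = e ∷ edgesOf S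

  ∈-edgesOf⁺ : {e : Edge G} (S : List (TObj G)) → edge e ∈ S → e ∈ edgesOf S
  ∈-edgesOf⁺ (edge _ ∷ S) (here refl) = here refl
  ∈-edgesOf⁺ (vert _ ∷ S) (there e∈S) = ∈-edgesOf⁺ S e∈S
  ∈-edgesOf⁺ (edge _ ∷ S) (there e∈S) = there (∈-edgesOf⁺ S e∈S)

  ∈-edgesOf⁻ : {e : Edge G} (S : List (TObj G)) → e ∈ edgesOf S → edge e ∈ S
  ∈-edgesOf⁻ (vert _ ∷ S) e∈S         = there (∈-edgesOf⁻ S e∈S)
  ∈-edgesOf⁻ (edge _ ∷ S) (here refl) = here refl
  ∈-edgesOf⁻ (edge _ ∷ S) (there e∈S) = there (∈-edgesOf⁻ S e∈S)

  edgeNb≤totalNb : (S : List (TObj G)) (e : Edge G) →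
                   count (edgeNb {G} e) (edgesOf S) ≤ count (totalNb {G} (edge e)) S
  edgeNb≤totalNb []           e = z≤n
  edgeNb≤totalNb (vert v ∷ S) e =
    ≤-trans (edgeNb≤totalNb S e) (count-∷-≤ (totalNb {G} (edge e)) (vert v) S)
  edgeNb≤totalNb (edge f ∷ S) e with edgeNb {G} e f
  ... | true  = s≤s (edgeNb≤totalNb S e)
  ... | false = edgeNb≤totalNb S e

  edgeNb<totalNb : (S : List (TObj G)) (e : Edge G) {u : Fin (n G)} → vert u ∈ S →
                   incV {G} u e ≡ true →
                   count (edgeNb {G} e) (edgesOf S) < count (totalNb {G} (edge e)) S
  edgeNb<totalNb (vert u ∷ S) e (here refl) u∈e with incV {G} u e
  ... | true = s≤s (edgeNb≤totalNb S e)
  edgeNb<totalNb (vert v ∷ S) e (there u∈S) u∈e =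
    ≤-trans (edgeNb<totalNb S e u∈S u∈e) (count-∷-≤ (totalNb {G} (edge e)) (vert v) S)
  edgeNb<totalNb (edge f ∷ S) e (there u∈S) u∈e with edgeNb {G} e f
  ... | true  = s≤s (edgeNb<totalNb S e u∈S u∈e)
  ... | false = edgeNb<totalNb S e u∈S u∈e

module StrategyTransfer (G : Graph) (k : ℕ) where

  open GraphObjects G

  module E = Game (edgeNb {G}) k
  module T = Game (totalNb {G}) k

  -- Simulation invariant: the real edge position R is a rearrangement of
  -- the edges marked in the imaginary total position S.
  record Shadows (R : List (Edge G)) (S : List (TObj G)) : Set where
    constructor shadows
    field permutation : R ↭ edgesOf S
  open Shadows using (permutation)

  shadow-edge : ∀ {R S} (e : Edge G) → Shadows R S → Shadows (e ∷ R) (edge e ∷ S)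
  shadow-edge e (shadows σ) = shadows (prep e σ)

  shadow-vertex : ∀ {R S} (v : Fin (n G)) → Shadows R S → Shadows R (vert v ∷ S)
  shadow-vertex v (shadows σ) = shadows σ

  shadow-swap : ∀ {R S} (f g : Edge G) → Shadows R S → Shadows (g ∷ f ∷ R) (edge f ∷ edge g ∷ S)
  shadow-swap f g (shadows σ) = shadows (swap g f σ)

  AllVerticesMarked : List (TObj G) → Set
  AllVerticesMarked S = ∀ u → vert u ∈ S

  module _ {R : List (Edge G)} {S : List (TObj G)} (σ : Shadows R S) where

    shadow-∉ : {e : Edge G} → e ∉ R → edge e ∉ S
    shadow-∉ e∉R e∈S = e∉R (∈-resp-↭ (↭-sym (permutation σ)) (∈-edgesOf⁺ S e∈S))

    shadow-∉⁻ : {e : Edge G} → edge e ∉ S → e ∉ R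
    shadow-∉⁻ e∉S e∈R = e∉S (∈-edgesOf⁻ S (∈-resp-↭ (permutation σ) e∈R))

    shadow-≤ : (e : Edge G) → E.markedNb R e ≤ T.markedNb S (edge e)
    shadow-≤ e = ≤-trans (≤-reflexive (count-↭ (edgeNb {G} e) (permutation σ))) (edgeNb≤totalNb S e)

    shadow-< : (e : Edge G) {u : Fin (n G)} → vert u ∈ S → incV {G} u e ≡ true →
               E.markedNb R e < T.markedNb S (edge e)
    shadow-< e u∈S u∈e =
      ≤-<-trans (≤-reflexive (count-↭ (edgeNb {G} e) (permutation σ))) (edgeNb<totalNb S e u∈S u∈e)

    shadow-good : T.Good S → E.Good R
    shadow-good good e e∉R = ≤-<-trans (shadow-≤ e) (good (edge e) (shadow-∉ e∉R))

    shadow-allMarked : T.AllMarked S → E.AllMarked R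
    shadow-allMarked all e = ∈-resp-↭ (↭-sym (permutation σ)) (∈-edgesOf⁺ S (all (edge e)))

  src-incident : (e : Edge G) → incV {G} (src {G} e) e ≡ true
  src-incident e with src {G} e ≟ src {G} e
  ... | yes _    = refl
  ... | no u≢u = ⊥-elim (u≢u refl)

  -- The imaginary game is one move ahead: Alice's total strategy marked g
  -- (not yet played for real) and Bob really marked f.  Then the real
  -- position f ∷ R is good: g is paid for by its marked endpoint, every
  -- other edge is compared with the imaginary position after both moves.
  delayed-good : ∀ {R S} {f g : Edge G} → Shadows R S → AllVerticesMarked S →
                 T.Good S → edge g ∉ S → T.Good (edge f ∷ edge g ∷ S) → E.Good (f ∷ R)
  delayed-good {R} {S} {f} {g} σ allV goodS g∉S goodAfter x x∉fR with x ≟E g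
  ... | yes refl = ≤-<-trans (≤-trans (count-∷-≤suc (edgeNb {G} g) f R)
                                      (shadow-< σ g (allV (src {G} g)) (src-incident g)))
                             (goodS (edge g) g∉S)
  ... | no x≢g = ≤-<-trans (≤-trans (count-∷-≤ (edgeNb {G} x) g (f ∷ R)) (shadow-≤ σ′ x))
                           (goodAfter (edge x) (shadow-∉ σ′ x∉gfR))
    where
      σ′ : Shadows (g ∷ f ∷ R) (edge f ∷ edge g ∷ S)
      σ′ = shadow-swap f g σ

      x∉gfR : x ∉ g ∷ f ∷ R
      x∉gfR (here x≡g)   = x≢g x≡g
      x∉gfR (there x∈fR) = x∉fR x∈fR

  good : ∀ {S t} → T.AWin S t → T.Good S
  good (T.finished goodS _)       = goodS
  good (T.aliceMoves goodS _ _ _) = goodS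
  good (T.bobMoves goodS _)       = goodS

  -- The strategy, by recursion on Alice's total-game certificate.
  -- In step: both games have the same player to move.
  inStepAlice  : ∀ {R S} → Shadows R S → T.AWin S alice → E.AWin R alice
  inStepBob    : ∀ {R S} → Shadows R S → T.AWin S bob → E.AWin R bob
  -- Alice's total strategy has just moved; she now chooses a move for the
  -- imaginary Bob (an unmarked vertex if any, otherwise her own real edge).
  imaginaryBob : ∀ {R S} → Shadows R S → T.AWin S bob → E.AWin R alice
  -- Ahead: all vertices marked, total game one move ahead of the real one.
  aheadBob     : ∀ {R S} → Shadows R S → AllVerticesMarked S → T.AWin S alice → E.AWin R bob
  -- Bob really answered f while Alice's total strategy had marked g.
  delayedReply : ∀ {R S} {g : Edge G} → Shadows R S → AllVerticesMarked S → T.Good S →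
                 edge g ∉ S → T.AWin (edge g ∷ S) bob → (f : Edge G) → f ∉ R → E.AWin (f ∷ R) alice

  inStepAlice σ (T.finished goodS all) = E.finished (shadow-good σ goodS) (shadow-allMarked σ all)
  inStepAlice σ (T.aliceMoves _ (vert v) _ w) = imaginaryBob (shadow-vertex v σ) w
  inStepAlice σ (T.aliceMoves goodS (edge g) g∉S w) =
    E.aliceMoves (shadow-good σ goodS) g (shadow-∉⁻ σ g∉S) (inStepBob (shadow-edge g σ) w)

  inStepBob σ (T.finished goodS all) = E.finished (shadow-good σ goodS) (shadow-allMarked σ all)
  inStepBob σ (T.bobMoves goodS next) =
    E.bobMoves (shadow-good σ goodS) λ f f∉R →
      inStepAlice (shadow-edge f σ) (next (edge f) (shadow-∉ σ f∉R))

  imaginaryBob σ (T.finished goodS all) = E.finished (shadow-good σ goodS) (shadow-allMarked σ all)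
  imaginaryBob {R} {S} σ (T.bobMoves goodS next) with unmarkedVertex S
  ... | inj₂ (u , u∉S) = inStepAlice (shadow-vertex u σ) (next (vert u) u∉S)
  ... | inj₁ allV with unmarkedEdge R
  ...   | inj₁ allE      = E.finished (shadow-good σ goodS) allE
  ...   | inj₂ (e , e∉R) =
          E.aliceMoves (shadow-good σ goodS) e e∉R
            (aheadBob (shadow-edge e σ) (λ u → there (allV u)) (next (edge e) (shadow-∉ σ e∉R)))

  aheadBob σ _ (T.finished goodS all) = E.finished (shadow-good σ goodS) (shadow-allMarked σ all)
  aheadBob σ allV (T.aliceMoves _ (vert v) v∉S _) = ⊥-elim (v∉S (allV v))
  aheadBob σ allV (T.aliceMoves goodS (edge g) g∉S w) =
    E.bobMoves (shadow-good σ goodS) (delayedReply σ allV goodS g∉S w)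

  delayedReply {g = g} σ allV goodS g∉S w f f∉R with f ≟E g
  ... | yes refl = imaginaryBob (shadow-edge f σ) w
  delayedReply σ _ _ _ (T.finished _ all) f f∉R | no f≢g with all (edge f)
  ... | here f≡g  = ⊥-elim (f≢g (edge-injective f≡g))
  ... | there f∈S = ⊥-elim (shadow-∉ σ f∉R f∈S)
  delayedReply {R} {S} {g} σ allV goodS g∉S (T.bobMoves _ next) f f∉R | no f≢g =
    E.aliceMoves (delayed-good σ allV goodS g∉S (good (next (edge f) f∉gS))) g g∉fR
      (aheadBob (shadow-swap f g σ) (λ u → there (there (allV u))) (next (edge f) f∉gS))
    where
      f∉gS : edge f ∉ edge g ∷ S
      f∉gS (here f≡g)  = f≢g (edge-injective f≡g)
      f∉gS (there f∈S) = shadow-∉ σ f∉R f∈S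

      g∉fR : g ∉ f ∷ R
      g∉fR (here refl) = f≢g refl
      g∉fR (there g∈R) = shadow-∉⁻ σ g∉S g∈R

  transfer : T.AliceWins → E.AliceWins
  transfer = inStepAlice (shadows ↭-refl)

mainTheorem4 : (G : Graph) (k k″ : ℕ) →
    IsGameColoringIndex G k → IsTotalGameColoringNumber G k″ → k ≤ k″
mainTheorem4 G k k″ (_ , leastEdge) (aliceWinsTotal , _) =
  leastEdge k″ (StrategyTransfer.transfer G k″ aliceWinsTotal)
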